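{- Let $X$ be a finite set with a partition $\pi$, and let $\alpha$ be a zero jump permutation of $(X,\pi)$. Then $|I|=|D|$.
   Context: For $i\in X$ let $\overline{i}$ be the block of $\pi$ containing $i$, $S(i)=\ln|\overline{i}|$, $D=\{i:S(\alpha(i))<S(i)\}$, $I=\{i:S(\alpha(i))>S(i)\}$. For $n,m\in\mathbb{N}$, $\langle n,m\rangle$ denotes the open interval between $n$ and $m$ ($(n,m)$ if $n\le m$, $(m,n)$ otherwise). The jump of $\alpha$ at $i$ is the number of distinct values $|a|$, $a\in\pi$, lying in $\langle|\overline{i}|,|\overline{\alpha(i)}|\rangle$; $\alpha$ is a zero jump permutation if its jump at every $i\in X$ is $0$, i.e. no block of $\pi$ has cardinality strictly between $|\overline{i}|$ and $|\overline{\alpha(i)}|$. -}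

module Defs where

open import Data.Nat using (ℕ; _<_; _<?_)
open import Data.Fin using (Fin)
open import Data.Fin.Properties using (_≟_)
open import Data.List using (List; length; filter)
open import Data.List.Base using (allFin)
open import Data.Product using (∃; _×_)
open import Data.Sum using (_⊎_)
open import Relation.Binary.PropositionalEquality using (_≡_)
open import Relation.Nullary using (¬_)
open import Data.Fin.Permutation using (Permutation′; _⟨$⟩ʳ_)

-- The partition π is given by a block
-- labelling  blk : Fin n → Fin k : two elements lie in the same block
-- iff they have the same label (the blocks of π are the nonempty fibres).

block : ∀ {n k} → (Fin n → Fin k) → Fin n → List (Fin n)
block {n} blk i = filter (λ j → blk j ≟ blk i) (allFin n)

blockSize : ∀ {n k} → (Fin n → Fin k) → Fin n → ℕ
blockSize blk i = length (block blk i)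

InOpen : ℕ → ℕ → ℕ → Set
InOpen a b m = (a < m × m < b) ⊎ (b < m × m < a)

-- zero jump: no block a ∈ π (every block is j̄ for some j ∈ X) has
-- cardinality strictly between |ī| and |ᾱ(i)|
ZeroJump : ∀ {n k} → (Fin n → Fin k) → Permutation′ n → Set
ZeroJump {n} blk α =
  ∀ (i : Fin n) → ¬ ∃ λ (j : Fin n) →
    InOpen (blockSize blk i) (blockSize blk (α ⟨$⟩ʳ i)) (blockSize blk j)

-- S(i) = ln |ī|; since ln is strictly increasing on positive naturals,
-- S(α i) < S(i)  ⟺  |ᾱ(i)| < |ī|.
-- D = { i : S(α(i)) < S(i) }
Dset : ∀ {n k} → (Fin n → Fin k) → Permutation′ n → List (Fin n)
Dset {n} blk α =
  filter (λ i → blockSize blk (α ⟨$⟩ʳ i) <? blockSize blk i) (allFin n)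

Iset : ∀ {n k} → (Fin n → Fin k) → Permutation′ n → List (Fin n)
Iset {n} blk α =
  filter (λ i → blockSize blk i <? blockSize blk (α ⟨$⟩ʳ i)) (allFin n)

module Submission where

-- Let V be the set of block sizes occurring in π and let
-- rank t be the number of elements of V below t.  For every i ∈ X put
-- x = |ī| and y = |ᾱ(i)|; both lie in V, and the zero jump condition
-- says no element of V lies strictly between them.  Hence
--     rank y + [y < x] = rank x + [x < y],
-- i.e. rank ∘ size increases by one along i ↦ α(i) exactly when i ∈ I
-- and decreases by one exactly when i ∈ D.  Summing over X and using
-- that α permutes X (so the rank terms cancel) gives |I| = |D|.

open import Defs
open import Data.Nat using (ℕ; zero; suc; _+_; _<_; _<?_; s≤s)
open import Data.Nat.Properties
  using (_≟_; +-0-commutativeMonoid; +-identityʳ; +-cancelˡ-≡; ≤-refl;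
         m≤n⇒m<n∨m≡n; m<n⇒m<1+n; <⇒≯; ≤∧≮⇒≡; ≮⇒≥)
open import Data.Fin using (Fin; zero; suc)
open import Data.Fin.Properties using (any?)
open import Data.Fin.Permutation using (Permutation′; _⟨$⟩ʳ_)
open import Data.List using (length; filter)
open import Data.List.Base using (tabulate)
open import Data.Product using (∃; _,_)
open import Data.Sum using (inj₁; inj₂)
open import Function using (_∘_)
open import Level using (0ℓ)
open import Relation.Binary.PropositionalEquality
  using (_≡_; refl; sym; cong; module ≡-Reasoning)
open import Relation.Nullary using (Dec; yes; no; ¬_)
open import Relation.Nullary.Negation using (contradiction)
open import Relation.Unary using (Pred; Decidable)
open import Algebra.Properties.CommutativeMonoid.Sum +-0-commutativeMonoid
  using (sum; ∑-distrib-+; sum-cong-≗; sum-permute)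

open ≡-Reasoning

indicator : ∀ {p} {P : Set p} → Dec P → ℕ
indicator (yes _) = 1
indicator (no _)  = 0

length-filter-tabulate : ∀ {n} {A : Set} {P : Pred A 0ℓ} (P? : Decidable P) (g : Fin n → A) →
  length (filter P? (tabulate g)) ≡ sum (λ i → indicator (P? (g i)))
length-filter-tabulate {zero}  P? g = refl
length-filter-tabulate {suc n} P? g with P? (g zero)
... | yes _ = cong suc (length-filter-tabulate P? (g ∘ suc))
... | no _  = length-filter-tabulate P? (g ∘ suc)

-- Balance along a permutation: if a potential g changes by u i − d i
-- when passing from i to α(i), then the total gains equal the total
-- losses, because the potential sums to the same value before and after.
balance : ∀ {n} (α : Permutation′ n) (g u d : Fin n → ℕ) →
  (∀ i → g (α ⟨$⟩ʳ i) + d i ≡ g i + u i) → sum u ≡ sum d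
balance α g u d step = +-cancelˡ-≡ (sum g) (sum u) (sum d) (begin
  sum g + sum u                        ≡⟨ sym (∑-distrib-+ g u) ⟩
  sum (λ i → g i + u i)                ≡⟨ sym (sum-cong-≗ step) ⟩
  sum (λ i → g (α ⟨$⟩ʳ i) + d i)       ≡⟨ ∑-distrib-+ (g ∘ (α ⟨$⟩ʳ_)) d ⟩
  sum (g ∘ (α ⟨$⟩ʳ_)) + sum d          ≡⟨ cong (_+ sum d) (sym (sum-permute g α)) ⟩
  sum g + sum d                        ∎)

module Rank (V : ℕ → Set) (V? : Decidable V) where

  rank : ℕ → ℕ
  rank zero    = 0
  rank (suc m) = rank m + indicator (V? m)

  rank-step : ∀ {a b} → a < b → V a → (∀ t → a < t → t < b → ¬ V t) →
    rank b ≡ rank a + 1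
  rank-step {a} {suc b} (s≤s a≤b) va gap with m≤n⇒m<n∨m≡n a≤b
  ... | inj₂ refl with V? a
  ...   | yes _   = refl
  ...   | no ¬va  = contradiction va ¬va
  rank-step {a} {suc b} (s≤s a≤b) va gap | inj₁ a<b with V? b
  ...   | yes vb  = contradiction vb (gap b a<b (s≤s ≤-refl))
  ...   | no _    = begin
    rank b + 0  ≡⟨ +-identityʳ (rank b) ⟩
    rank b      ≡⟨ rank-step a<b va (λ t a<t t<b → gap t a<t (m<n⇒m<1+n t<b)) ⟩
    rank a + 1  ∎

  rank-balance : ∀ {x y} → V x → V y → (∀ t → InOpen x y t → ¬ V t) →
    rank y + indicator (y <? x) ≡ rank x + indicator (x <? y)
  rank-balance {x} {y} vx vy gap with x <? y | y <? x
  ... | yes x<y | yes y<x = contradiction y<x (<⇒≯ x<y)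
  ... | yes x<y | no _    = begin
    rank y + 0  ≡⟨ +-identityʳ (rank y) ⟩
    rank y      ≡⟨ rank-step x<y vx (λ t x<t t<y → gap t (inj₁ (x<t , t<y))) ⟩
    rank x + 1  ∎
  ... | no _    | yes y<x = begin
    rank y + 1  ≡⟨ rank-step y<x vy (λ t y<t t<x → gap t (inj₂ (y<t , t<x))) ⟨
    rank x      ≡⟨ +-identityʳ (rank x) ⟨
    rank x + 0  ∎
  ... | no x≮y  | no y≮x  = cong (λ t → rank t + 0) (sym (≤∧≮⇒≡ (≮⇒≥ y≮x) x≮y))

mainTheorem17 : (n k : ℕ) (blk : Fin n → Fin k) (α : Permutation′ n) →
    ZeroJump blk α → length (Iset blk α) ≡ length (Dset blk α)
mainTheorem17 n k blk α zeroJump = begin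
  length (Iset blk α)                           ≡⟨ length-filter-tabulate increases (λ i → i) ⟩
  sum (λ i → indicator (increases i))           ≡⟨ balance α (rank ∘ size) _ _ rank-changes ⟩
  sum (λ i → indicator (decreases i))           ≡⟨ length-filter-tabulate decreases (λ i → i) ⟨
  length (Dset blk α)                           ∎
  where
  size : Fin n → ℕ
  size = blockSize blk

  IsBlockSize : ℕ → Set
  IsBlockSize t = ∃ λ j → size j ≡ t

  open Rank IsBlockSize (λ t → any? (λ j → size j ≟ t))

  increases : (i : Fin n) → Dec (size i < size (α ⟨$⟩ʳ i))
  increases i = size i <? size (α ⟨$⟩ʳ i)

  decreases : (i : Fin n) → Dec (size (α ⟨$⟩ʳ i) < size i)
  decreases i = size (α ⟨$⟩ʳ i) <? size i

  -- the zero jump hypothesis is exactly the gap condition of rank-balance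
  rank-changes : ∀ i → rank (size (α ⟨$⟩ʳ i)) + indicator (decreases i)
                     ≡ rank (size i) + indicator (increases i)
  rank-changes i = rank-balance (i , refl) (α ⟨$⟩ʳ i , refl)
    (λ { t t∈⟨⟩ (j , refl) → zeroJump i (j , t∈⟨⟩) })
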